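{- Let $H$ be a graph with degree sequence $\pi(H)=(h_1,\ldots,h_k)$ (nonincreasing), and let $\pi=(d_1,\ldots,d_n)$ be a graphic sequence with $d_1\le M$ such that there are terms $d_{i_1},\ldots,d_{i_k}$ of $\pi$ (with distinct indices $i_1,\ldots,i_k$) satisfying $d_{i_j}\ge h_j$ for $1\le j\le k$. If $\pi$ has at least $2M^2+k$ positive terms, then there is a realization $G$ of $\pi$ containing a copy of $H$ that lies on vertices of degrees $d_{i_1},\ldots,d_{i_k}$.
   Context: A sequence of nonnegative integers is graphic if it is the degree sequence of some finite simple graph, called a realization; graphic sequences are written in nonincreasing order. -}

module Defs where

open import Data.Nat using (ℕ; _+_; _*_; _≤_; _≥_; _<ᵇ_)
open import Data.Bool using (Bool; true; false; if_then_else_)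
open import Data.Fin using (Fin; _<_)
open import Data.List using (map; allFin)
open import Data.Nat.ListAction using (sum)
open import Data.Product using (Σ; _×_; ∃)
open import Relation.Binary.PropositionalEquality using (_≡_)
open import Function.Definitions using (Injective)

record SimpleGraph (n : ℕ) : Set where
  field
    adj    : Fin n → Fin n → Bool
    sym    : ∀ i j → adj i j ≡ adj j i
    irrefl : ∀ i → adj i i ≡ false
open SimpleGraph public

ind : Bool → ℕ
ind b = if b then 1 else 0

deg : ∀ {n} → SimpleGraph n → Fin n → ℕ
deg {n} G i = sum (map (λ j → ind (adj G i j)) (allFin n))

Nonincreasing : ∀ {n} → (Fin n → ℕ) → Set
Nonincreasing d = ∀ i j → i < j → d j ≤ d i

Realizes : ∀ {n} → SimpleGraph n → (Fin n → ℕ) → Set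
Realizes G d = ∀ i → deg G i ≡ d i

Graphic : ∀ {n} → (Fin n → ℕ) → Set
Graphic {n} d = Nonincreasing d × Σ (SimpleGraph n) (λ G → Realizes G d)

positiveTerms : ∀ {n} → (Fin n → ℕ) → ℕ
positiveTerms {n} d = sum (map (λ i → ind (0 <ᵇ d i)) (allFin n))

Embeds : ∀ {k n} → SimpleGraph k → SimpleGraph n → (Fin k → Fin n) → Set
Embeds H G ι = Injective _≡_ _≡_ ι ×
  (∀ a b → adj H a b ≡ true → adj G (ι a) (ι b) ≡ true)

module Submission where

-- Start from any realization G₀ of d and insert the images ι a ι b of the
-- edges ab of H one at a time, using 2-switches (which preserve all degrees)
-- that never remove an image of an H-edge.  To insert a missing edge
-- uv = ι a ι b, pick neighbours x of u and y of v such that ux and vy are not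
-- images of H-edges; they exist as d (ι a) ≥ deg H a while ι b is not yet a
-- neighbour of u.  If x ≠ y are non-adjacent, the switch ux, vy ↦ uv, xy
-- inserts uv.  Otherwise y lies in the closed neighbourhood N[x], which
-- reaches fewer than M + M² ≤ 2M² of the at least 2M² vertices of positive
-- degree outside the image of ι; so one of them, w, has no neighbour in N[x],
-- and for a neighbour z of w the switches xu, zw ↦ xz, uw and
-- uw, vy ↦ uv, wy insert uv.

open import Defs hiding (sym)
open import Data.Nat using (ℕ; zero; suc; _+_; _*_; _≤_; _≥_; _<_; z≤n; s≤s; s≤s⁻¹; _<ᵇ_; _<?_)
open import Data.Nat.Properties hiding (_≟_)
open import Algebra.Properties.Semiring.Sum +-*-semiring
  using (sum; sum-cong-≗; ∑-comm; ∑-distrib-+; *-distribʳ-sum; ∑-permute; sum-replicate-zero)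
import Data.Nat.ListAction as List
open import Data.Bool using (Bool; true; false; _∧_; _∨_; not; if_then_else_)
open import Data.Bool.Properties using (∧-assoc; ∨-zeroʳ)
open import Data.Fin using (Fin; zero; suc)
open import Data.Fin.Properties using (_≟_; any?)
import Data.Fin.Permutation as Perm
open import Data.Fin.Permutation.Components using (transpose)
open import Data.List using (List; []; _∷_; map; allFin; tabulate; cartesianProduct)
open import Data.List.Properties using (map-tabulate)
open import Data.List.Membership.Propositional using (_∈_)
open import Data.List.Membership.Propositional.Properties using (∈-cartesianProduct⁺; ∈-allFin)
open import Data.List.Relation.Unary.Any using (here; there)
open import Data.Product using (Σ; _×_; _,_; ∃)
open import Data.Sum using (_⊎_; inj₁; inj₂; [_,_])
import Data.Sum as Sum
open import Relation.Nullary using (¬_; Dec; yes; no; does; _×-dec_; _⊎-dec_)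
open import Relation.Nullary.Decidable using (dec-true; dec-false; does-⇔)
open import Relation.Binary.PropositionalEquality
  using (_≡_; _≢_; refl; sym; trans; cong; subst; subst₂; ≢-sym; module ≡-Reasoning)
open import Function using (_∘_; id; mk⇔)
open import Function.Definitions using (Injective)

sum-tabulate : ∀ {n} (f : Fin n → ℕ) → List.sum (tabulate f) ≡ sum f
sum-tabulate {zero} f = refl
sum-tabulate {suc n} f = cong (f zero +_) (sum-tabulate (f ∘ suc))

sum-allFin : ∀ {n} (f : Fin n → ℕ) → List.sum (map f (allFin n)) ≡ sum f
sum-allFin {n} f = trans (cong List.sum (map-tabulate id f)) (sum-tabulate f)

deg-sum : ∀ {n} (G : SimpleGraph n) i → deg G i ≡ sum (λ j → ind (adj G i j))
deg-sum G i = sum-allFin (λ j → ind (adj G i j))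

sum-mono : ∀ {n} {f g : Fin n → ℕ} → (∀ i → f i ≤ g i) → sum f ≤ sum g
sum-mono {zero} f≤g = z≤n
sum-mono {suc n} f≤g = +-mono-≤ (f≤g zero) (sum-mono (f≤g ∘ suc))

sum-mono-< : ∀ {n} {f g : Fin n → ℕ} → (∀ i → f i ≤ g i) → ∀ j → f j < g j → sum f < sum g
sum-mono-< {suc n} f≤g zero f<g = +-mono-<-≤ f<g (sum-mono (f≤g ∘ suc))
sum-mono-< {suc n} f≤g (suc j) f<g = +-mono-≤-< (f≤g zero) (sum-mono-< (f≤g ∘ suc) j f<g)

term≤sum : ∀ {n} (f : Fin n → ℕ) i → f i ≤ sum f
term≤sum f zero = m≤m+n _ _
term≤sum f (suc i) = ≤-trans (term≤sum (f ∘ suc) i) (m≤n+m _ _)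

sum-witness : ∀ {n} (f g : Fin n → ℕ) → sum f < sum g → ∃ λ i → f i < g i
sum-witness {suc n} f g f<g with f zero <? g zero
... | yes lt = zero , lt
... | no ¬lt with sum-witness (f ∘ suc) (g ∘ suc)
                    (+-cancelˡ-< (g zero) _ _ (≤-<-trans (+-monoˡ-≤ _ (≮⇒≥ ¬lt)) f<g))
... | i , lt = suc i , lt

sum-exchange : ∀ {n} (f g : Fin n → ℕ) (s t : Fin n) → g s ≡ f t → g t ≡ f s →
  (∀ x → x ≢ s → x ≢ t → g x ≡ f x) → sum g ≡ sum f
sum-exchange f g s t gs gt rest =
  trans (sum-cong-≗ g≗f∘τ) (sym (∑-permute f (Perm.transpose s t)))
  where
  g≗f∘τ : ∀ x → g x ≡ f (transpose s t x)
  g≗f∘τ x with x ≟ s | x ≟ t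
  ... | yes refl | _ = gs
  ... | no x≢s | yes refl rewrite dec-true (x ≟ x) refl = gt
  ... | no x≢s | no x≢t rewrite dec-false (x ≟ t) x≢t = rest x x≢s x≢t

sum-ones : ∀ n → sum {n} (λ _ → 1) ≡ n
sum-ones zero = refl
sum-ones (suc n) = cong suc (sum-ones n)

ind≤1 : ∀ b → ind b ≤ 1
ind≤1 true = ≤-refl
ind≤1 false = z≤n

ind-∧ : ∀ a b → ind (a ∧ b) ≡ ind a * ind b
ind-∧ true b = sym (+-identityʳ (ind b))
ind-∧ false b = refl

ind-∧≤ : ∀ a b → ind (a ∧ b) ≤ ind a
ind-∧≤ true b = ind≤1 b
ind-∧≤ false b = z≤n

ind-∨ : ∀ a b → ind (a ∨ b) ≤ ind a + ind b
ind-∨ true b = m≤m+n 1 (ind b)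
ind-∨ false b = ≤-refl

sum-δ : ∀ {n} (c : Fin n) (f : Fin n → ℕ) → sum (λ x → ind (does (c ≟ x)) * f x) ≡ f c
sum-δ {suc n} zero f = trans (cong (f zero + 0 +_) (sum-replicate-zero n)) (trans (+-identityʳ _) (+-identityʳ _))
sum-δ {suc n} (suc c) f = sum-δ c (f ∘ suc)

sum-at : ∀ {n} (c : Fin n) (P : Fin n → Bool) → sum (λ x → ind (does (c ≟ x) ∧ P x)) ≡ ind (P c)
sum-at c P = trans (sum-cong-≗ (λ x → ind-∧ (does (c ≟ x)) (P x))) (sum-δ c (ind ∘ P))

sum-point : ∀ {n} (c : Fin n) → sum (λ x → ind (does (c ≟ x))) ≡ 1
sum-point c =
  trans (sum-cong-≗ {x = λ x → ind (does (c ≟ x))} (λ x → sym (*-identityʳ _))) (sum-δ c (λ _ → 1))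

sum-guard : ∀ {n} t (g : Fin n → Bool) → sum (λ p → ind (t ∧ g p)) ≡ ind t * sum (λ p → ind (g p))
sum-guard true g = sym (+-identityʳ _)
sum-guard {n} false g = sum-replicate-zero n

avoid : ∀ {m n} (S : Fin m → Fin n → Bool) (A : Fin n → Bool) →
  sum (λ i → sum (λ p → ind (S i p ∧ A p))) < sum (λ p → ind (A p)) →
  ∃ λ p → A p ≡ true × (∀ i → S i p ≡ false)
avoid S A small with sum-witness (λ p → sum (λ i → ind (S i p ∧ A p))) (λ p → ind (A p))
                       (subst (_< sum (λ p → ind (A p))) (∑-comm (λ i p → ind (S i p ∧ A p))) small)
... | p , lt with A p in Ap
...   | true = p , Ap , missed
  where
  missed : ∀ i → S i p ≡ false
  missed i with S i p | ≤-trans (term≤sum (λ i → ind (S i p ∧ true)) i) (s≤s⁻¹ lt)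
  ... | false | _ = refl
  ... | true | ()

n≤n*n : ∀ n → n ≤ n * n
n≤n*n zero = z≤n
n≤n*n (suc n) = m≤m+n (suc n) (n * suc n)

positive : ∀ {m} → (0 <ᵇ m) ≡ true → 0 < m
positive {suc m} _ = s≤s z≤n

Pair : ∀ {n} → Fin n → Fin n → Fin n → Fin n → Set
Pair p q s t = (p ≡ s × q ≡ t) ⊎ (p ≡ t × q ≡ s)

pair? : ∀ {n} (p q s t : Fin n) → Dec (Pair p q s t)
pair? p q s t = (p ≟ s ×-dec q ≟ t) ⊎-dec (p ≟ t ×-dec q ≟ s)

Pair-flip : ∀ {n} {p q s t : Fin n} → Pair p q s t → Pair q p s t
Pair-flip (inj₁ (p≡s , q≡t)) = inj₂ (q≡t , p≡s)
Pair-flip (inj₂ (p≡t , q≡s)) = inj₁ (q≡s , p≡t)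

Pair-swap : ∀ {n} {p q s t : Fin n} → Pair p q s t → Pair p q t s
Pair-swap (inj₁ eqs) = inj₂ eqs
Pair-swap (inj₂ eqs) = inj₁ eqs

Pair-diag : ∀ {n} {p s t : Fin n} → Pair p p s t → s ≡ t
Pair-diag (inj₁ (p≡s , p≡t)) = trans (sym p≡s) p≡t
Pair-diag (inj₂ (p≡t , p≡s)) = trans (sym p≡s) p≡t

¬Pair : ∀ {n} {p q s t : Fin n} → (p ≢ s ⊎ q ≢ t) → (p ≢ t ⊎ q ≢ s) → ¬ Pair p q s t
¬Pair (inj₁ p≢s) _ (inj₁ (p≡s , _)) = p≢s p≡s
¬Pair (inj₂ q≢t) _ (inj₁ (_ , q≡t)) = q≢t q≡t
¬Pair _ (inj₁ p≢t) (inj₂ (p≡t , _)) = p≢t p≡t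
¬Pair _ (inj₂ q≢s) (inj₂ (_ , q≡s)) = q≢s q≡s

¬Pair-away : ∀ {n} {p q s t : Fin n} → s ≢ p → t ≢ p → ¬ Pair p q s t
¬Pair-away s≢p t≢p = ¬Pair (inj₁ (≢-sym s≢p)) (inj₁ (≢-sym t≢p))

adj-sym : ∀ {n} (G : SimpleGraph n) {p q} {b : Bool} → adj G p q ≡ b → adj G q p ≡ b
adj-sym G {p} {q} e = trans (SimpleGraph.sym G q p) e

adj-Pair : ∀ {n} (G : SimpleGraph n) {p q s t} {b : Bool} → Pair p q s t → adj G s t ≡ b → adj G p q ≡ b
adj-Pair G (inj₁ (refl , refl)) e = e
adj-Pair G (inj₂ (refl , refl)) e = adj-sym G e

adj-≢ : ∀ {n} (G : SimpleGraph n) {p q} → adj G p q ≡ true → p ≢ q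
adj-≢ G {p} e refl with () ← trans (sym e) (SimpleGraph.irrefl G p)

adj-separates : ∀ {n} (G : SimpleGraph n) {p q r} → adj G p q ≡ true → adj G p r ≡ false → q ≢ r
adj-separates G e e′ refl with () ← trans (sym e) e′

-- A 2-switch replaces two edges ab, cd of G by the non-edges ac, bd.
record Switchable {n} (G : SimpleGraph n) (a b c d : Fin n) : Set where
  field
    ab : adj G a b ≡ true
    cd : adj G c d ≡ true
    ac : adj G a c ≡ false
    bd : adj G b d ≡ false
    a≢c : a ≢ c
    b≢d : b ≢ d

module Switch {n} {G : SimpleGraph n} {a b c d : Fin n} (sw : Switchable G a b c d) where
  open Switchable sw

  Removed Added : Fin n → Fin n → Set
  Removed p q = Pair p q a b ⊎ Pair p q c d
  Added p q = Pair p q a c ⊎ Pair p q b d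

  removed? : ∀ p q → Dec (Removed p q)
  removed? p q = pair? p q a b ⊎-dec pair? p q c d

  added? : ∀ p q → Dec (Added p q)
  added? p q = pair? p q a c ⊎-dec pair? p q b d

  switchAdj : Fin n → Fin n → Bool
  switchAdj p q = if does (removed? p q) then false else if does (added? p q) then true else adj G p q

  -- removal and addition depend only on the unordered pair
  switchAdj-sym : ∀ p q → switchAdj p q ≡ switchAdj q p
  switchAdj-sym p q
    rewrite does-⇔ (mk⇔ (Sum.map Pair-flip Pair-flip) (Sum.map Pair-flip Pair-flip)) (removed? p q) (removed? q p)
          | does-⇔ (mk⇔ (Sum.map Pair-flip Pair-flip) (Sum.map Pair-flip Pair-flip)) (added? p q) (added? q p)
          | SimpleGraph.sym G p q = refl

  switchAdj-irrefl : ∀ p → switchAdj p p ≡ false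
  switchAdj-irrefl p with does (removed? p p)
  ... | true = refl
  ... | false rewrite dec-false (added? p p) [ a≢c ∘ Pair-diag , b≢d ∘ Pair-diag ] =
    SimpleGraph.irrefl G p

  switched : SimpleGraph n
  switched = record { adj = switchAdj ; sym = switchAdj-sym ; irrefl = switchAdj-irrefl }

  removed-edge : ∀ {p q} → Removed p q → adj G p q ≡ true
  removed-edge (inj₁ P) = adj-Pair G P ab
  removed-edge (inj₂ P) = adj-Pair G P cd

  added-nonedge : ∀ {p q} → Added p q → adj G p q ≡ false
  added-nonedge (inj₁ P) = adj-Pair G P ac
  added-nonedge (inj₂ P) = adj-Pair G P bd

  removes : ∀ {p q} → Removed p q → switchAdj p q ≡ false
  removes {p} {q} R rewrite dec-true (removed? p q) R = refl

  added-not-removed : ∀ {p q} → Added p q → ¬ Removed p q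
  added-not-removed A R with () ← trans (sym (removed-edge R)) (added-nonedge A)

  adds : ∀ {p q} → Added p q → switchAdj p q ≡ true
  adds {p} {q} A rewrite dec-false (removed? p q) (added-not-removed A) | dec-true (added? p q) A = refl

  keeps-edge : ∀ {p q} → adj G p q ≡ true → ¬ Removed p q → switchAdj p q ≡ true
  keeps-edge {p} {q} e ¬R rewrite dec-false (removed? p q) ¬R with does (added? p q)
  ... | true = refl
  ... | false = e

  keeps-nonedge : ∀ {p q} → adj G p q ≡ false → ¬ Added p q → switchAdj p q ≡ false
  keeps-nonedge {p} {q} e ¬A with does (removed? p q)
  ... | true = refl
  ... | false rewrite dec-false (added? p q) ¬A = e

  Untouched : Fin n → Fin n → Set
  Untouched p q = ¬ Removed p q × ¬ Added p q

  unchanged : ∀ {p q} → Untouched p q → switchAdj p q ≡ adj G p q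
  unchanged {p} {q} (¬R , ¬A) rewrite dec-false (removed? p q) ¬R | dec-false (added? p q) ¬A = refl

  row-degree : ∀ p s t → Removed p s → Added p t → (∀ x → x ≢ s → x ≢ t → Untouched p x) →
    sum (λ x → ind (switchAdj p x)) ≡ sum (λ x → ind (adj G p x))
  row-degree p s t R A untouched =
    sum-exchange (ind ∘ adj G p) (ind ∘ switchAdj p) s t
      (cong ind (trans (removes R) (sym (added-nonedge A))))
      (cong ind (trans (adds A) (sym (removed-edge R))))
      (λ x x≢s x≢t → cong ind (unchanged (untouched x x≢s x≢t)))

  a≢b : a ≢ b
  a≢b = adj-≢ G ab
  c≢d : c ≢ d
  c≢d = adj-≢ G cd
  b≢c : b ≢ c
  b≢c = adj-separates G ab ac
  a≢d : a ≢ d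
  a≢d = ≢-sym (adj-separates G cd (adj-sym G ac))

  -- a trades b for c, b trades a for d, c trades d for a, d trades c for b;
  -- the rows of all other vertices are untouched
  row-preserved : ∀ p → sum (λ x → ind (switchAdj p x)) ≡ sum (λ x → ind (adj G p x))
  row-preserved p with a ≟ p | b ≟ p | c ≟ p | d ≟ p
  ... | yes refl | _ | _ | _ = row-degree a b c (inj₁ (inj₁ (refl , refl))) (inj₁ (inj₁ (refl , refl)))
    λ x x≢b x≢c → [ ¬Pair (inj₂ x≢b) (inj₁ a≢b) , ¬Pair (inj₁ a≢c) (inj₁ a≢d) ]
                , [ ¬Pair (inj₂ x≢c) (inj₁ a≢c) , ¬Pair (inj₁ a≢b) (inj₁ a≢d) ]
  ... | no _ | yes refl | _ | _ = row-degree b a d (inj₁ (inj₂ (refl , refl))) (inj₂ (inj₁ (refl , refl)))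
    λ x x≢a x≢d → [ ¬Pair (inj₁ (≢-sym a≢b)) (inj₂ x≢a) , ¬Pair (inj₁ b≢c) (inj₁ b≢d) ]
                , [ ¬Pair (inj₁ (≢-sym a≢b)) (inj₁ b≢c) , ¬Pair (inj₂ x≢d) (inj₁ b≢d) ]
  ... | no _ | no _ | yes refl | _ = row-degree c d a (inj₂ (inj₁ (refl , refl))) (inj₁ (inj₂ (refl , refl)))
    λ x x≢d x≢a → [ ¬Pair-away a≢c b≢c , ¬Pair (inj₂ x≢d) (inj₁ c≢d) ]
                , [ ¬Pair (inj₁ (≢-sym a≢c)) (inj₂ x≢a) , ¬Pair (inj₁ (≢-sym b≢c)) (inj₁ c≢d) ]
  ... | no _ | no _ | no _ | yes refl = row-degree d c b (inj₂ (inj₂ (refl , refl))) (inj₂ (inj₂ (refl , refl)))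
    λ x x≢c x≢b → [ ¬Pair-away a≢d b≢d , ¬Pair (inj₁ (≢-sym c≢d)) (inj₂ x≢c) ]
                , [ ¬Pair-away a≢d c≢d , ¬Pair (inj₁ (≢-sym b≢d)) (inj₂ x≢b) ]
  ... | no a≢p | no b≢p | no c≢p | no d≢p =
    sum-cong-≗ {x = ind ∘ switchAdj p} λ x → cong ind (unchanged
      ( [ ¬Pair-away a≢p b≢p , ¬Pair-away c≢p d≢p ] , [ ¬Pair-away a≢p c≢p , ¬Pair-away b≢p d≢p ] ))

  realizes : ∀ {δ : Fin n → ℕ} → Realizes G δ → Realizes switched δ
  realizes {δ} r p = begin
    deg switched p                  ≡⟨ deg-sum switched p ⟩
    sum (λ x → ind (switchAdj p x)) ≡⟨ row-preserved p ⟩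
    sum (λ x → ind (adj G p x))     ≡⟨ deg-sum G p ⟨
    deg G p                         ≡⟨ r p ⟩
    δ p                             ∎
    where open ≡-Reasoning

module Construction {k n} (H : SimpleGraph k) (d : Fin n → ℕ) (M : ℕ) (ι : Fin k → Fin n)
  (ι-injective : Injective _≡_ _≡_ ι) (d≤M : ∀ i → d i ≤ M) (room : ∀ j → d (ι j) ≥ deg H j)
  (many-positive : positiveTerms d ≥ 2 * (M * M) + k) where

  -- pq is free if it is not the image of an edge of H; switches may remove free edges
  Free : Fin n → Fin n → Set
  Free p q = ∀ a b → adj H a b ≡ true → ¬ Pair (ι a) (ι b) p q

  Free-swap : ∀ {p q} → Free p q → Free q p
  Free-swap free a b h = free a b h ∘ Pair-swap

  Outside : Fin n → Set
  Outside w = ∀ j → ι j ≢ w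

  outside-free : ∀ {w q} → Outside w → Free w q
  outside-free out a b h (inj₁ (ιa≡w , _)) = out a ιa≡w
  outside-free out a b h (inj₂ (_ , ιb≡w)) = out b ιb≡w

  Keeps : SimpleGraph n → SimpleGraph n → Set
  Keeps G G' = ∀ a b → adj H a b ≡ true → adj G (ι a) (ι b) ≡ true → adj G' (ι a) (ι b) ≡ true

  Keeps-trans : ∀ {G G' G''} → Keeps G G' → Keeps G' G'' → Keeps G G''
  Keeps-trans k₁ k₂ a b h = k₂ a b h ∘ k₁ a b h

  switch-keeps : ∀ {G a b c e} (sw : Switchable G a b c e) → Free a b → Free c e →
    Keeps G (Switch.switched sw)
  switch-keeps sw free-ab free-ce a′ b′ h present =
    Switch.keeps-edge sw present [ free-ab a′ b′ h , free-ce a′ b′ h ]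

  -- If the image of an H-edge ab is missing from a realization G, then ι a has
  -- a neighbour x with ι a x free: ι a has d (ι a) ≥ deg H a neighbours, while
  -- fewer than deg H a of them are images of neighbours of a (b is not).
  free-neighbour : ∀ {G} → Realizes G d → ∀ a b → adj H a b ≡ true → adj G (ι a) (ι b) ≡ false →
    ∃ λ x → adj G (ι a) x ≡ true × Free (ι a) x
  free-neighbour {G} r a b hab missing with avoid (λ j x → does (ι j ≟ x) ∧ adj H a j) (adj G (ι a)) few
    where
    open ≤-Reasoning
    few : sum (λ j → sum (λ x → ind ((does (ι j ≟ x) ∧ adj H a j) ∧ adj G (ι a) x)))
          < sum (λ x → ind (adj G (ι a) x))
    few = begin-strict
      sum (λ j → sum (λ x → ind ((does (ι j ≟ x) ∧ adj H a j) ∧ adj G (ι a) x)))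
        ≡⟨ sum-cong-≗ (λ j → trans (sum-cong-≗ (λ x → cong ind (∧-assoc (does (ι j ≟ x)) _ _)))
                                   (sum-at (ι j) (λ x → adj H a j ∧ adj G (ι a) x))) ⟩
      sum (λ j → ind (adj H a j ∧ adj G (ι a) (ι j)))
        <⟨ sum-mono-< (λ j → ind-∧≤ (adj H a j) _) b
             (subst₂ (λ h g → ind (h ∧ g) < ind h) (sym hab) (sym missing) (s≤s z≤n)) ⟩
      sum (λ j → ind (adj H a j))
        ≡⟨ deg-sum H a ⟨
      deg H a
        ≤⟨ room a ⟩
      d (ι a)
        ≡⟨ trans (sym (r (ι a))) (deg-sum G (ι a)) ⟩
      sum (λ x → ind (adj G (ι a) x)) ∎
  ... | x , ux , missed = x , ux , free
    where
    not-neighbour : ∀ j → ι j ≡ x → adj H a j ≡ false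
    not-neighbour j ιj≡x = subst (λ t → t ∧ adj H a j ≡ false) (dec-true (ι j ≟ x) ιj≡x) (missed j)
    free : Free (ι a) x
    free a′ b′ h (inj₁ (ιa′≡ιa , ιb′≡x)) with refl ← ι-injective ιa′≡ιa
      with () ← trans (sym h) (not-neighbour b′ ιb′≡x)
    free a′ b′ h (inj₂ (ιa′≡x , ιb′≡ιa)) with refl ← ι-injective ιb′≡ιa
      with () ← trans (sym (adj-sym H h)) (not-neighbour a′ ιa′≡x)

  -- Vertices usable for a detour: outside the image of ι and of positive degree.
  available : Fin n → Bool
  available p = not (does (any? (λ j → ι j ≟ p))) ∧ (0 <ᵇ d p)

  available-outside : ∀ {p} → available p ≡ true → Outside p
  available-outside {p} avail j ιj≡p with any? (λ j → ι j ≟ p) | avail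
  ... | yes _ | ()
  ... | no ¬image | _ = ¬image (j , ιj≡p)

  available-positive : ∀ {p} → available p ≡ true → (0 <ᵇ d p) ≡ true
  available-positive {p} avail with does (any? (λ j → ι j ≟ p)) | avail
  ... | true | ()
  ... | false | positive-degree = positive-degree

  image-unavailable : ∀ j → available (ι j) ≡ false
  image-unavailable j rewrite dec-true (any? (λ i → ι i ≟ ι j)) (j , refl) = refl

  -- Discarding the k image vertices leaves at least 2M² available vertices.
  many-available : 2 * (M * M) ≤ sum (λ p → ind (available p))
  many-available = +-cancelʳ-≤ k _ _ (begin
    2 * (M * M) + k
      ≤⟨ many-positive ⟩
    positiveTerms d
      ≡⟨ sum-allFin (λ p → ind (0 <ᵇ d p)) ⟩
    sum (λ p → ind (0 <ᵇ d p))
      ≤⟨ sum-mono positive-or-image ⟩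
    sum (λ p → ind (available p) + sum (λ j → ind (does (ι j ≟ p))))
      ≡⟨ ∑-distrib-+ (λ p → ind (available p)) _ ⟩
    sum (λ p → ind (available p)) + sum (λ p → sum (λ j → ind (does (ι j ≟ p))))
      ≡⟨ cong (sum (λ p → ind (available p)) +_) image-size ⟩
    sum (λ p → ind (available p)) + k ∎)
    where
    open ≤-Reasoning
    positive-or-image : ∀ p → ind (0 <ᵇ d p) ≤ ind (available p) + sum (λ j → ind (does (ι j ≟ p)))
    positive-or-image p with any? (λ j → ι j ≟ p)
    ... | yes (j , ιj≡p) =
      ≤-trans (ind≤1 _) (≤-trans (≤-reflexive (sym (cong ind (dec-true (ι j ≟ p) ιj≡p))))
                                 (term≤sum (λ j → ind (does (ι j ≟ p))) j))
    ... | no _ = m≤m+n _ _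
    image-size : sum (λ p → sum (λ j → ind (does (ι j ≟ p)))) ≡ k
    image-size = begin-equality
      sum (λ p → sum (λ j → ind (does (ι j ≟ p))))  ≡⟨ ∑-comm (λ p j → ind (does (ι j ≟ p))) ⟩
      sum (λ j → sum (λ p → ind (does (ι j ≟ p))))  ≡⟨ sum-cong-≗ (λ j → sum-point (ι j)) ⟩
      sum {k} (λ _ → 1)                             ≡⟨ sum-ones k ⟩
      k                                             ∎

  row≤M : ∀ {G} → Realizes G d → ∀ c → sum (λ p → ind (adj G c p)) ≤ M
  row≤M {G} r c = ≤-trans (≤-reflexive (trans (sym (deg-sum G c)) (r c))) (d≤M c)

  availableDegree : SimpleGraph n → Fin n → ℕ
  availableDegree G c = sum (λ p → ind (adj G c p ∧ available p))

  availableDegree≤M : ∀ {G} → Realizes G d → ∀ c → availableDegree G c ≤ M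
  availableDegree≤M {G} r c =
    ≤-trans (sum-mono {g = λ p → ind (adj G c p)} (λ p → ind-∧≤ (adj G c p) (available p))) (row≤M {G} r c)

  -- a neighbour in the image is not available, so such a vertex has fewer than M
  availableDegree<M : ∀ {G} → Realizes G d → ∀ {c} j → adj G c (ι j) ≡ true → availableDegree G c < M
  availableDegree<M {G} r {c} j cι =
    <-≤-trans (sum-mono-< {g = λ p → ind (adj G c p)} (λ p → ind-∧≤ (adj G c p) (available p)) (ι j) lost)
              (row≤M {G} r c)
    where
    lost : ind (adj G c (ι j) ∧ available (ι j)) < ind (adj G c (ι j))
    lost rewrite cι | image-unavailable j = s≤s z≤n

  Near : SimpleGraph n → Fin n → Fin n → Set
  Near G x c = c ≡ x ⊎ adj G x c ≡ true

  near? : SimpleGraph n → Fin n → Fin n → Bool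
  near? G x c = does (x ≟ c) ∨ adj G x c

  near?-complete : ∀ {G x c} → Near G x c → near? G x c ≡ true
  near?-complete {G} {x} (inj₁ refl) = cong (_∨ adj G x x) (dec-true (x ≟ x) refl)
  near?-complete {G} {x} {c} (inj₂ xc) = trans (cong (does (x ≟ c) ∨_) xc) (∨-zeroʳ _)

  -- The vertices near x reach, counted with multiplicity, at most
  -- availableDegree G x + M·M available vertices: x itself, and at most M
  -- neighbours with at most M available neighbours each.
  near-reach : ∀ {G} → Realizes G d → ∀ x →
    sum (λ c → sum (λ p → ind ((near? G x c ∧ adj G c p) ∧ available p))) ≤ availableDegree G x + M * M
  near-reach {G} r x = begin
    sum (λ c → sum (λ p → ind ((near? G x c ∧ adj G c p) ∧ available p)))
      ≡⟨ sum-cong-≗ (λ c → trans (sum-cong-≗ (λ p → cong ind (∧-assoc (near? G x c) (adj G c p) _)))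
                                 (sum-guard (near? G x c) (λ p → adj G c p ∧ available p))) ⟩
    sum (λ c → ind (near? G x c) * aD c)
      ≤⟨ sum-mono (λ c → *-monoˡ-≤ (aD c) (ind-∨ (does (x ≟ c)) (adj G x c))) ⟩
    sum (λ c → (ind (does (x ≟ c)) + ind (adj G x c)) * aD c)
      ≡⟨ trans (sum-cong-≗ (λ c → *-distribʳ-+ (aD c) (ind (does (x ≟ c))) _))
               (∑-distrib-+ (λ c → ind (does (x ≟ c)) * aD c) (λ c → ind (adj G x c) * aD c)) ⟩
    sum (λ c → ind (does (x ≟ c)) * aD c) + sum (λ c → ind (adj G x c) * aD c)
      ≡⟨ cong (_+ sum (λ c → ind (adj G x c) * aD c)) (sum-δ x aD) ⟩
    aD x + sum (λ c → ind (adj G x c) * aD c)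
      ≤⟨ +-monoʳ-≤ (aD x) (sum-mono (λ c → *-monoʳ-≤ (ind (adj G x c)) (availableDegree≤M {G} r c))) ⟩
    aD x + sum (λ c → ind (adj G x c) * M)
      ≡⟨ cong (aD x +_) (*-distribʳ-sum M (λ c → ind (adj G x c))) ⟨
    aD x + sum (λ c → ind (adj G x c)) * M
      ≤⟨ +-monoʳ-≤ (aD x) (*-monoˡ-≤ M (row≤M {G} r x)) ⟩
    aD x + M * M ∎
    where
    open ≤-Reasoning
    aD : Fin n → ℕ
    aD = availableDegree G

  -- If x has a neighbour in the image, then x has fewer than M available
  -- neighbours, so the vertices near x reach fewer than M + M·M ≤ 2M²
  -- available vertices, and some available vertex w has no neighbour near x.
  far-vertex : ∀ {G} → Realizes G d → ∀ {x} j → adj G x (ι j) ≡ true →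
    ∃ λ w → available w ≡ true × (∀ c → Near G x c → adj G c w ≡ false)
  far-vertex {G} r {x} j xι with avoid (λ c p → near? G x c ∧ adj G c p) available reach
    where
    open ≤-Reasoning
    reach : sum (λ c → sum (λ p → ind ((near? G x c ∧ adj G c p) ∧ available p)))
            < sum (λ p → ind (available p))
    reach = begin-strict
      sum (λ c → sum (λ p → ind ((near? G x c ∧ adj G c p) ∧ available p)))
        ≤⟨ near-reach {G} r x ⟩
      availableDegree G x + M * M
        <⟨ +-monoˡ-< (M * M) (availableDegree<M {G} r j xι) ⟩
      M + M * M
        ≤⟨ +-monoˡ-≤ (M * M) (n≤n*n M) ⟩
      M * M + M * M
        ≡⟨ cong (M * M +_) (+-identityʳ (M * M)) ⟨
      2 * (M * M)
        ≤⟨ many-available ⟩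
      sum (λ p → ind (available p)) ∎
  ... | w , avail , missed =
    w , avail , λ c near → subst (λ t → t ∧ adj G c w ≡ false) (near?-complete {G} near) (missed c)

  has-neighbour : ∀ {G} → Realizes G d → ∀ {w} → (0 <ᵇ d w) ≡ true → ∃ λ z → adj G w z ≡ true
  has-neighbour {G} r {w} pos with sum-witness {n} (λ _ → 0) (λ z → ind (adj G w z)) nonzero
    where
    nonzero : sum {n} (λ _ → 0) < sum (λ z → ind (adj G w z))
    nonzero = subst₂ _<_ (sym (sum-replicate-zero n)) (trans (sym (r w)) (deg-sum G w)) (positive pos)
  ... | z , lt with adj G w z in e | lt
  ... | true | _ = z , e
  ... | false | ()

  Insertion : SimpleGraph n → Fin n → Fin n → Set
  Insertion G u v = Σ (SimpleGraph n) λ G' → Realizes G' d × adj G' u v ≡ true × Keeps G G'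

  direct-insertion : ∀ {G u v x y} → Realizes G d → adj G u x ≡ true → adj G v y ≡ true →
    adj G u v ≡ false → adj G x y ≡ false → u ≢ v → x ≢ y → Free u x → Free v y → Insertion G u v
  direct-insertion {G} {u} {v} {x} {y} r ux vy uv xy u≢v x≢y free-ux free-vy =
    switched , realizes r , adds (inj₁ (inj₁ (refl , refl))) , switch-keeps sw free-ux free-vy
    where
    sw : Switchable G u x v y
    sw = record { ab = ux ; cd = vy ; ac = uv ; bd = xy ; a≢c = u≢v ; b≢d = x≢y }
    open Switch sw

  -- The direct switch is blocked when y is x itself or a neighbour of x.  A
  -- detour then uses an edge wz with w outside the image and without
  -- neighbours in the closed neighbourhood of x.
  record Detour (G : SimpleGraph n) (u v x y w z : Fin n) : Set where
    field
      ux : adj G u x ≡ true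
      vy : adj G v y ≡ true
      uv : adj G u v ≡ false
      u≢v : u ≢ v
      free-ux : Free u x
      free-vy : Free v y
      near-y : Near G x y
      w-outside : Outside w
      v≢w : v ≢ w
      w-far : ∀ c → Near G x c → adj G c w ≡ false
      wz : adj G w z ≡ true

  -- The first step of a detour: the switch xu, zw ↦ xz, uw makes w a
  -- neighbour of u along a free edge and leaves the pairs vy, uv, wy alone,
  -- so that afterwards the direct switch uw, vy ↦ uv, wy applies.
  module Reroute {G u v x y w z} (D : Detour G u v x y w z) where
    open Detour D

    x≁w : adj G x w ≡ false
    x≁w = w-far x (inj₁ refl)
    u≁w : adj G u w ≡ false
    u≁w = w-far u (inj₂ (adj-sym G ux))

    -- z is not a neighbour of x, since w has no neighbour near x
    x≁z : adj G x z ≡ false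
    x≁z with adj G x z in xz
    ... | false = refl
    ... | true with () ← trans (sym (adj-sym G wz)) (w-far z (inj₂ xz))

    -- w is not near x: it differs from x, since u ~ x but u ≁ w
    w-not-near : ¬ Near G x w
    w-not-near (inj₁ w≡x) = adj-separates G ux u≁w (sym w≡x)
    w-not-near (inj₂ xw) with () ← trans (sym xw) x≁w

    w≢y : w ≢ y
    w≢y refl = w-not-near near-y
    x≢z : x ≢ z
    x≢z = ≢-sym (adj-separates G wz (adj-sym G x≁w))
    u≢w : u ≢ w
    u≢w = adj-separates G (adj-sym G ux) x≁w
    u≢z : u ≢ z
    u≢z = adj-separates G (adj-sym G ux) x≁z
    y≢u : y ≢ u
    y≢u = adj-separates G vy (adj-sym G uv)

    reroute : Switchable G x u z w
    reroute = record
      { ab = adj-sym G ux ; cd = adj-sym G wz ; ac = x≁z ; bd = u≁w ; a≢c = x≢z ; b≢d = u≢w }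
    open Switch reroute public using (switched; realizes)
    open Switch reroute using (adds; keeps-edge; keeps-nonedge)

    keeps : Keeps G switched
    keeps = switch-keeps reroute (Free-swap free-ux) (Free-swap (outside-free w-outside))

    uw′ : adj switched u w ≡ true
    uw′ = adds (inj₂ (inj₁ (refl , refl)))
    vy′ : adj switched v y ≡ true
    vy′ = keeps-edge vy [ ¬Pair (inj₂ y≢u) (inj₁ (≢-sym u≢v)) , ¬Pair (inj₂ (≢-sym w≢y)) (inj₁ v≢w) ]
    uv′ : adj switched u v ≡ false
    uv′ = keeps-nonedge uv [ ¬Pair (inj₁ (adj-≢ G ux)) (inj₁ u≢z) , ¬Pair (inj₂ v≢w) (inj₁ u≢w) ]
    wy′ : adj switched w y ≡ false
    wy′ = keeps-nonedge (adj-sym G (w-far y near-y))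
            [ ¬Pair (inj₁ (w-not-near ∘ inj₁)) (inj₁ (adj-≢ G wz)) , ¬Pair (inj₁ (≢-sym u≢w)) (inj₂ y≢u) ]

  detour-insertion : ∀ {G u v x y w z} → Realizes G d → Detour G u v x y w z → Insertion G u v
  detour-insertion {G} r D with direct-insertion {switched} (realizes r) uw′ vy′ uv′ wy′ u≢v w≢y
                                  (Free-swap (outside-free w-outside)) free-vy
    where
    open Detour D
    open Reroute D
  ... | G′ , r′ , uv-present , keeps′ =
    G′ , r′ , uv-present , Keeps-trans {G} {Reroute.switched D} {G′} (Reroute.keeps D) keeps′

  ι-distinct : ∀ {a b} → adj H a b ≡ true → ι a ≢ ι b
  ι-distinct hab = adj-≢ H hab ∘ ι-injective

  -- When y is near x, a far available vertex w (x is adjacent to the image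
  -- vertex ι a) and a neighbour z of w (w has positive degree) give a detour.
  near-insertion : ∀ {G} → Realizes G d → ∀ {a b x y} → adj H a b ≡ true →
    adj G (ι a) x ≡ true → Free (ι a) x → adj G (ι b) y ≡ true → Free (ι b) y →
    adj G (ι a) (ι b) ≡ false → Near G x y → Insertion G (ι a) (ι b)
  near-insertion {G} r {a} {b} hab ux free-ux vy free-vy uv near-y
    with far-vertex {G} r a (adj-sym G ux)
  ... | w , avail , w-far with has-neighbour {G} r (available-positive avail)
  ... | z , wz = detour-insertion {G} r record
    { ux = ux ; vy = vy ; uv = uv ; u≢v = ι-distinct hab ; free-ux = free-ux ; free-vy = free-vy
    ; near-y = near-y ; w-outside = available-outside avail ; v≢w = available-outside avail b
    ; w-far = w-far ; wz = wz }

  insert-edge : ∀ {G} → Realizes G d → ∀ a b → adj H a b ≡ true → Insertion G (ι a) (ι b)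
  insert-edge {G} r a b hab with adj G (ι a) (ι b) in present
  ... | true = G , r , present , λ _ _ _ e → e
  ... | false with free-neighbour {G} r a b hab present
                 | free-neighbour {G} r b a (adj-sym H hab) (adj-sym G present)
  ...   | x , ux , free-ux | y , vy , free-vy with x ≟ y | adj G x y in xy
  ...     | no x≢y | false = direct-insertion {G} r ux vy present xy (ι-distinct hab) x≢y free-ux free-vy
  ...     | yes refl | _ = near-insertion {G} r hab ux free-ux vy free-vy present (inj₁ refl)
  ...     | no _ | true = near-insertion {G} r hab ux free-ux vy free-vy present (inj₂ xy)

  Covers : SimpleGraph n → List (Fin k × Fin k) → Set
  Covers G L = ∀ a b → (a , b) ∈ L → adj H a b ≡ true → adj G (ι a) (ι b) ≡ true

  -- Insert the H-edges of L one at a time; each insertion keeps the earlier ones.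
  cover : ∀ {G₀} → Realizes G₀ d → (L : List (Fin k × Fin k)) →
    Σ (SimpleGraph n) λ G → Realizes G d × Covers G L
  cover {G₀} r₀ [] = G₀ , r₀ , λ _ _ ()
  cover {G₀} r₀ ((a , b) ∷ L) with cover {G₀} r₀ L
  ... | G , r , covered with adj H a b in hab
  ...   | false = G , r , covered′
    where
    covered′ : Covers G ((a , b) ∷ L)
    covered′ _ _ (here refl) h with () ← trans (sym h) hab
    covered′ a′ b′ (there m) h = covered a′ b′ m h
  ...   | true with insert-edge {G} r a b hab
  ...     | G′ , r′ , inserted , keeps = G′ , r′ , covered′
    where
    covered′ : Covers G′ ((a , b) ∷ L)
    covered′ _ _ (here refl) _ = inserted
    covered′ a′ b′ (there m) h = keeps a′ b′ h (covered a′ b′ m h)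

lemma2p3 : ∀ {k n} (H : SimpleGraph k) (d : Fin n → ℕ) (M : ℕ) (ι : Fin k → Fin n) →
    Nonincreasing (deg H) →
    Graphic d →
    (∀ i → d i ≤ M) →
    Injective _≡_ _≡_ ι →
    (∀ j → d (ι j) ≥ deg H j) →
    positiveTerms d ≥ 2 * (M * M) + k →
    Σ (SimpleGraph n) (λ G → Realizes G d × Embeds H G ι)
lemma2p3 {k} H d M ι _ (_ , G₀ , r₀) d≤M ι-injective room many-positive
  with cover {G₀} r₀ (cartesianProduct (allFin k) (allFin k))
  where open Construction H d M ι ι-injective d≤M room many-positive
... | G , r , covered =
  G , r , ι-injective , λ a b → covered a b (∈-cartesianProduct⁺ (∈-allFin a) (∈-allFin b))
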